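{- Let $H$ be a graph with vertex set $[k]$, $k\ge3$. Then $E_H$ pp-defines the relation $\mathrm{NEQ}_k=\{(x,x')\in[k]^2: x\neq x'\}$ if and only if $H$ is a projective core.
   Context: Graphs are finite, simple, undirected, loopless. $H$ is a core if every homomorphism (edge-preserving map) $H\to H$ is bijective. An $m$-ary polymorphism of $H$ is a map $f:V_H^m\to V_H$ such that whenever $(a_j,b_j)\in E_H$ for all $j\in[m]$, $(f(a_1,\dots,a_m),f(b_1,\dots,b_m))\in E_H$; it is idempotent if $f(x,\dots,x)=x$ for all $x$. $H$ is projective if every idempotent polymorphism is a projection $(x_1,\dots,x_m)\mapsto x_i$. A relation $R'$ of arity $n$ over $V$ is pp-definable from $R$ if $R'(x_1,\dots,x_n)\equiv\exists x_{n+1},\dots,x_{n+n'}\colon R(\mathbf{x}_1)\wedge\dots\wedge R(\mathbf{x}_p)\wedge\mathrm{EQ}(\mathbf{y}_1)\wedge\dots\wedge\mathrm{EQ}(\mathbf{y}_q)$ with tuples $\mathbf{x}_i,\mathbf{y}_i$ of variables among $x_1,\dots,x_{n+n'}$, where $\mathrm{EQ}=\{(x,x):x\in V\}$. -}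

module Defs where

open import Data.Nat using (ℕ; _+_)
open import Data.Fin using (Fin; zero; suc)
open import Data.Bool using (Bool; T)
import Data.Empty
open import Data.Vec using (Vec; []; _∷_; lookup; replicate; _++_)
open import Data.Vec.Relation.Binary.Pointwise.Inductive using (Pointwise)
open import Data.List using (List)
open import Data.List.Relation.Unary.All using (All)
open import Data.Product using (Σ; ∃; _×_)
open import Relation.Binary.PropositionalEquality using (_≡_; _≢_)
open import Function.Definitions using (Bijective)
open import Function.Bundles using (_⇔_)

record Graph (k : ℕ) : Set where
  field
    adj    : Fin k → Fin k → Bool
    sym    : ∀ x y → adj x y ≡ adj y x
    irrefl : ∀ x → T (adj x x) → Data.Empty.⊥
open Graph public

Edge : ∀ {k} → Graph k → Fin k → Fin k → Set
Edge H x y = T (adj H x y)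

IsHom : ∀ {k} → Graph k → (Fin k → Fin k) → Set
IsHom H h = ∀ x y → Edge H x y → Edge H (h x) (h y)

IsCore : ∀ {k} → Graph k → Set
IsCore {k} H = (h : Fin k → Fin k) → IsHom H h → Bijective _≡_ _≡_ h

Op : ℕ → ℕ → Set
Op k m = Vec (Fin k) m → Fin k

IsPolymorphism : ∀ {k m} → Graph k → Op k m → Set
IsPolymorphism {k} {m} H f =
  (as bs : Vec (Fin k) m) → Pointwise (Edge H) as bs → Edge H (f as) (f bs)

IsIdempotent : ∀ {k m} → Op k m → Set
IsIdempotent {k} {m} f = (x : Fin k) → f (replicate m x) ≡ x

IsProjection : ∀ {k m} → Op k m → Set
IsProjection {k} {m} f = Σ (Fin m) λ i → (as : Vec (Fin k) m) → f as ≡ lookup as i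

IsProjective : ∀ {k} → Graph k → Set
IsProjective {k} H =
  (m : ℕ) (f : Op k m) → IsPolymorphism H f → IsIdempotent f → IsProjection f

Rel : ℕ → ℕ → Set₁
Rel k n = Vec (Fin k) n → Set

EQ : ∀ {k} → Rel k 2
EQ (x ∷ y ∷ []) = x ≡ y

EdgeRel : ∀ {k} → Graph k → Rel k 2
EdgeRel H (x ∷ y ∷ []) = Edge H x y

NEQ : (k : ℕ) → Rel k 2
NEQ k (x ∷ y ∷ []) = x ≢ y

inst : ∀ {k N r} → Vec (Fin k) N → Vec (Fin N) r → Vec (Fin k) r
inst σ []       = []
inst σ (i ∷ is) = lookup σ i ∷ inst σ is

-- A primitive-positive formula over R (arity r) with n free variables
-- x_1..x_n and n' existentially quantified variables x_{n+1}..x_{n+n'}: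
-- a list of R-atoms and a list of EQ-atoms over the n+n' variables.
record PPFormula (r n : ℕ) : Set where
  field
    n'      : ℕ
    R-atoms : List (Vec (Fin (n + n')) r)
    EQ-atoms : List (Vec (Fin (n + n')) 2)
open PPFormula public

⟦_⟧ : ∀ {k r n} → PPFormula r n → Rel k r → Rel k n
⟦_⟧ {k} φ R xs =
  Σ (Vec (Fin k) (n' φ)) λ ys →
    All (λ a → R (inst (xs ++ ys) a)) (R-atoms φ) ×
    All (λ a → EQ (inst (xs ++ ys) a)) (EQ-atoms φ)

PPDefines : ∀ {k r n} → Rel k r → Rel k n → Set
PPDefines {k} {r} {n} R R' =
  Σ (PPFormula r n) λ φ → (xs : Vec (Fin k) n) → R' xs ⇔ ⟦ φ ⟧ R xs

{-# OPTIONS --safe #-}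
module Submission where

-- Polymorphisms of H preserve every relation pp-definable from E_H.  So if NEQ is
-- definable, every endomorphism of H is injective, hence bijective, and every
-- idempotent polymorphism f preserves ≠.  With at least three colours such an f is
-- a projection: read f as a voting rule on its m coordinates; whether a coalition
-- P can make colour c beat e (f picks c on the tuple that is c on P and e
-- elsewhere) does not depend on c and e, and these decisive coalitions form an
-- ultrafilter on the coordinates, which is principal.  Conversely, the canonical
-- pp-formula of the power H^m, with free variables at the two m-tuples listing all
-- ordered pairs of distinct vertices, defines {(g u, g v) | g polymorphism}.  In a
-- core, g followed by an inverse of its diagonal is an idempotent polymorphism,
-- hence a projection when H is projective, and a projection separates u from v.

open import Defs
open import Data.Nat using (ℕ; _≤_)
open import Data.Product using (_×_)
open import Function.Bundles using (_⇔_)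

import Data.Nat as ℕ
open import Data.Nat using (zero; suc; _+_; _*_; s≤s)
open import Data.Nat.Properties using (n<1+n; +-suc; m≤n⇒∃[o]m+o≡n)
open import Data.Bool using (Bool; true; false; T; not; _∧_; _∨_; if_then_else_)
open import Data.Bool.Properties using (T?; T-∧; T-≡)
open import Data.Fin using (Fin; zero; suc; toℕ; _≟_; _↑ˡ_; _↑ʳ_)
open import Data.Fin using (remQuot; combine; punchIn; punchOut; funToFin; finToFun)
open import Data.Fin.Properties
  using (pigeonhole; any?; finToFun-funToFin; remQuot-combine; punchInᵢ≢i; punchIn-punchOut)
open import Data.Vec using (Vec; []; _∷_; lookup; tabulate; replicate; _++_)
open import Data.Vec.Properties
  using (lookup∘tabulate; tabulate∘lookup; tabulate-cong; lookup-replicate; lookup-++ˡ; lookup-++ʳ)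
open import Data.Vec.Relation.Binary.Pointwise.Inductive as Pointwise using (Pointwise; []; _∷_)
open import Data.List using (List; []; _∷_; allFin; filter; cartesianProduct; map)
open import Data.List.Membership.Propositional using (_∈_)
open import Data.List.Membership.Propositional.Properties
  using (∈-allFin; ∈-filter⁺; ∈-filter⁻; ∈-cartesianProduct⁺; ∈-map⁺; ∈-map⁻)
open import Data.List.Relation.Unary.All as All using (All; []; _∷_)
open import Data.Product using (∃; ∃₂; _,_; proj₁; proj₂)
open import Data.Sum using (_⊎_; inj₁; inj₂; [_,_]′)
open import Function using (_∘_; id; const)
open import Function.Bundles using (mk⇔; Equivalence)
open import Function.Definitions using (Injective; Bijective)
open import Relation.Nullary using (¬_; Dec; yes; no; does; contradiction)
open import Relation.Nullary.Decidable using (dec-true; dec-false)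
open import Relation.Binary.PropositionalEquality as ≡
  using (_≡_; _≢_; refl; trans; cong; cong₂; cong-app; subst; subst₂; _≗_; module ≡-Reasoning)

open Equivalence using (to; from)
open ≡-Reasoning

private variable
  k m n r N : ℕ

Apart : {A : Set} → Vec A m → Vec A m → Set
Apart as bs = ∀ j → lookup as j ≢ lookup bs j

-- Polymorphisms preserve pp-definable relations

columnwise : Op k m → (Fin m → Vec (Fin k) n) → Vec (Fin k) n
columnwise f rows = tabulate λ i → f (tabulate λ j → lookup (rows j) i)

Preserves : Op k m → Rel k n → Set
Preserves f R = ∀ rows → (∀ j → R (rows j)) → R (columnwise f rows)

tabulate-++ : {A : Set} (n : ℕ) {n' : ℕ} (g : Fin (n + n') → A) →
  tabulate g ≡ tabulate (g ∘ (_↑ˡ n')) ++ tabulate (g ∘ (n ↑ʳ_))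
tabulate-++ zero    g = refl
tabulate-++ (suc n) g = cong (g zero ∷_) (tabulate-++ n (g ∘ suc))

columnwise-++ : (f : Op k m) (xs : Fin m → Vec (Fin k) n) (ys : Fin m → Vec (Fin k) N) →
  columnwise f (λ j → xs j ++ ys j) ≡ columnwise f xs ++ columnwise f ys
columnwise-++ {n = n} {N = N} f xs ys = trans (tabulate-++ n _) (cong₂ _++_
  (tabulate-cong λ i → cong f (tabulate-cong λ j → lookup-++ˡ (xs j) (ys j) i))
  (tabulate-cong λ i → cong f (tabulate-cong λ j → lookup-++ʳ (xs j) (ys j) i)))

columnwise-inst : (f : Op k m) (rows : Fin m → Vec (Fin k) N) (a : Vec (Fin N) r) →
  columnwise f (λ j → inst (rows j) a) ≡ inst (columnwise f rows) a
columnwise-inst f rows []      = refl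
columnwise-inst f rows (i ∷ a) =
  cong₂ _∷_ (≡.sym (lookup∘tabulate _ i)) (columnwise-inst f rows a)

preserves-atoms : (f : Op k m) {R : Rel k r} → Preserves f R →
  (rows : Fin m → Vec (Fin k) N) (atoms : List (Vec (Fin N) r)) →
  (∀ j → All (λ a → R (inst (rows j) a)) atoms) →
  All (λ a → R (inst (columnwise f rows) a)) atoms
preserves-atoms f {R} f-preserves-R rows atoms sat = All.tabulate λ {a} a∈atoms →
  subst R (columnwise-inst f rows a) (f-preserves-R _ λ j → All.lookup (sat j) a∈atoms)

preserves-EQ : (f : Op k m) → Preserves f EQ
preserves-EQ f rows equal = cong f (tabulate-cong λ j → entries-equal (rows j) (equal j))
  where
  entries-equal : (e : Vec _ 2) → EQ e → lookup e zero ≡ lookup e (suc zero)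
  entries-equal (x ∷ y ∷ []) x≡y = x≡y

preserves-⟦⟧ : (f : Op k m) {R : Rel k r} → Preserves f R →
  (φ : PPFormula r n) → Preserves f (⟦ φ ⟧ R)
preserves-⟦⟧ f {R} f-preserves-R φ rows sat =
  columnwise f witnesses ,
  subst (λ σ → All (λ a → R (inst σ a)) (R-atoms φ) × All (λ a → EQ (inst σ a)) (EQ-atoms φ))
    (columnwise-++ f rows witnesses)
    ( preserves-atoms f {R} f-preserves-R assignment (R-atoms φ)
        (λ j → proj₁ (proj₂ (sat j)))
    , preserves-atoms f {EQ} (preserves-EQ f) assignment (EQ-atoms φ)
        (λ j → proj₂ (proj₂ (sat j))))
  where
  witnesses = λ j → proj₁ (sat j)
  assignment = λ j → rows j ++ witnesses j

preserves-definable : (f : Op k m) {R : Rel k r} {R' : Rel k n} →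
  Preserves f R → PPDefines R R' → Preserves f R'
preserves-definable f {R} f-preserves-R (φ , R'⇔φ) rows sat =
  from (R'⇔φ _) (preserves-⟦⟧ f {R} f-preserves-R φ rows λ j → to (R'⇔φ _) (sat j))

polymorphism-preserves-edges : (H : Graph k) {f : Op k m} →
  IsPolymorphism H f → Preserves f (EdgeRel H)
polymorphism-preserves-edges H f-poly rows edges =
  f-poly _ _ (Pointwise.tabulate⁺ λ j → edge (rows j) (edges j))
  where
  edge : (e : Vec _ 2) → EdgeRel H e → Edge H (lookup e zero) (lookup e (suc zero))
  edge (x ∷ y ∷ []) xy = xy

preserves-NEQ⇒apart : {f : Op k m} → Preserves f (NEQ k) →
  ∀ {as bs} → Apart as bs → f as ≢ f bs
preserves-NEQ⇒apart {f = f} f-preserves-NEQ {as} {bs} as#bs fas≡fbs =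
  f-preserves-NEQ (λ j → lookup as j ∷ lookup bs j ∷ []) as#bs (begin
    f (tabulate (lookup as)) ≡⟨ cong f (tabulate∘lookup as) ⟩
    f as                     ≡⟨ fas≡fbs ⟩
    f bs                     ≡⟨ cong f (tabulate∘lookup bs) ⟨
    f (tabulate (lookup bs)) ∎)

NEQ-definable⇒polymorphism-apart : {H : Graph k} → PPDefines (EdgeRel H) (NEQ k) →
  {f : Op k m} → IsPolymorphism H f → ∀ {as bs} → Apart as bs → f as ≢ f bs
NEQ-definable⇒polymorphism-apart {H = H} NEQ-def {f} f-poly =
  preserves-NEQ⇒apart {f = f}
    (preserves-definable f {EdgeRel H} (polymorphism-preserves-edges H f-poly) NEQ-def)

-- Injective endomaps of a finite set are periodic

module _ {k : ℕ} where
  open import Function.Endo.Propositional (Fin k) using (_^_; ^-homo)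

  ^-injective : {α : Fin k → Fin k} → Injective _≡_ _≡_ α →
    ∀ d → Injective _≡_ _≡_ (α ^ d)
  ^-injective α-inj zero    = id
  ^-injective α-inj (suc d) = ^-injective α-inj d ∘ α-inj

  ^-isHom : (H : Graph k) {α : Fin k → Fin k} → IsHom H α → ∀ d → IsHom H (α ^ d)
  ^-isHom H α-hom zero    x y xy = xy
  ^-isHom H α-hom (suc d) x y xy = α-hom _ _ (^-isHom H α-hom d x y xy)

  -- Pigeonhole among the first k ^ k + 1 iterates, each coded in Fin (k ^ k) by funToFin.
  eventually-periodic : (α : Fin k → Fin k) → ∃₂ λ i d → α ^ i ≗ α ^ (i + suc d)
  eventually-periodic α
    with i , j , i<j , same-code ← pigeonhole (n<1+n (k ℕ.^ k)) (λ i → funToFin (α ^ toℕ i))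
    with d , 1+i+d≡j ← m≤n⇒∃[o]m+o≡n i<j
    = toℕ i , d , λ x → begin
      (α ^ toℕ i) x                      ≡⟨ finToFun-funToFin (α ^ toℕ i) x ⟨
      finToFun (funToFin (α ^ toℕ i)) x  ≡⟨ cong (λ code → finToFun code x) same-code ⟩
      finToFun (funToFin (α ^ toℕ j)) x  ≡⟨ finToFun-funToFin (α ^ toℕ j) x ⟩
      (α ^ toℕ j) x                      ≡⟨ cong (λ e → (α ^ e) x) j≡i+1+d ⟩
      (α ^ (toℕ i + suc d)) x            ∎
      where
      j≡i+1+d : toℕ j ≡ toℕ i + suc d
      j≡i+1+d = trans (≡.sym 1+i+d≡j) (≡.sym (+-suc (toℕ i) d))

  injective⇒periodic : {α : Fin k → Fin k} → Injective _≡_ _≡_ α →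
    ∃ λ d → ∀ x → (α ^ suc d) x ≡ x
  injective⇒periodic {α} α-inj with i , d , αⁱ≗αⁱ⁺ᵈ⁺¹ ← eventually-periodic α =
    d , λ x → ≡.sym (^-injective α-inj i (begin
      (α ^ i) x               ≡⟨ αⁱ≗αⁱ⁺ᵈ⁺¹ x ⟩
      (α ^ (i + suc d)) x     ≡⟨ cong-app (^-homo α i (suc d)) x ⟩
      (α ^ i) ((α ^ suc d) x) ∎))

  injective⇒bijective : {α : Fin k → Fin k} → Injective _≡_ _≡_ α → Bijective _≡_ _≡_ α
  injective⇒bijective α-inj with d , periodic ← injective⇒periodic α-inj =
    α-inj , λ y → _ , λ { refl → periodic y }

  injective-hom⇒inverse-hom : (H : Graph k) {α : Fin k → Fin k} →
    IsHom H α → Injective _≡_ _≡_ α → ∃ λ β → IsHom H β × (∀ x → β (α x) ≡ x)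
  injective-hom⇒inverse-hom H {α} α-hom α-inj with d , periodic ← injective⇒periodic α-inj =
    α ^ d , ^-isHom H α-hom d , λ x → α-inj (periodic (α x))

-- Idempotent operations preserving apartness on at least three colours

module IdempotentApartnessPreserving
  {n m : ℕ} (f : Op (3 + n) m)
  (f-idempotent : IsIdempotent f)
  (f-apart : ∀ {as bs} → Apart as bs → f as ≢ f bs)
  where

  Colour : Set
  Colour = Fin (3 + n)

  c₀ c₁ c₂ : Colour
  c₀ = zero
  c₁ = suc zero
  c₂ = suc (suc zero)

  third : (c c' : Colour) → ∃ λ g → g ≢ c × g ≢ c'
  third zero          zero          = c₁ , (λ ()) , (λ ())
  third zero          (suc zero)    = c₂ , (λ ()) , (λ ())
  third zero          (suc (suc _)) = c₁ , (λ ()) , (λ ())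
  third (suc zero)    zero          = c₂ , (λ ()) , (λ ())
  third (suc (suc _)) zero          = c₁ , (λ ()) , (λ ())
  third (suc _)       (suc _)       = c₀ , (λ ()) , (λ ())

  Coalition : Set
  Coalition = Fin m → Bool

  ∁ : Coalition → Coalition
  ∁ P = not ∘ P

  infixl 6 _∩_ _∖_
  infix  4 _⊆_

  _∩_ _∖_ : Coalition → Coalition → Coalition
  (P ∩ Q) i = P i ∧ Q i
  (P ∖ Q) i = P i ∧ not (Q i)

  ⁅_⁆ : Fin m → Coalition
  ⁅ t ⁆ i = does (i ≟ t)

  _⊆_ : Coalition → Coalition → Set
  P ⊆ Q = ∀ i → T (P i) → T (Q i)

  paint : Colour → Colour → Coalition → Vec Colour m
  paint c e P = tabulate λ i → if P i then c else e

  tricolour : Coalition → Coalition → Vec Colour m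
  tricolour A B = tabulate λ i → if B i then (if A i then c₀ else c₁) else c₂

  fibre : Vec Colour m → Colour → Coalition
  fibre a c i = does (lookup a i ≟ c)

  private variable
    c c' e e' x : Colour
    P Q : Coalition
    a : Vec Colour m

  -- Otherwise a would be apart from the constant tuple at f a, which f also maps to f a.
  f-conservative : (a : Vec Colour m) → ∃ λ i → lookup a i ≡ f a
  f-conservative a with any? (λ i → lookup a i ≟ f a)
  ... | yes found  = found
  ... | no  ¬found = contradiction (f-idempotent (f a)) λ f[fa,…,fa]≡fa →
    f-apart (λ i aᵢ≡fa → ¬found (i , trans aᵢ≡fa (lookup-replicate i (f a))))
            (≡.sym f[fa,…,fa]≡fa)

  f-tabulate : (g : Fin m → Colour) → ∃ λ i → g i ≡ f (tabulate g)
  f-tabulate g with i , aᵢ≡fa ← f-conservative (tabulate g) =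
    i , trans (≡.sym (lookup∘tabulate g i)) aᵢ≡fa

  f-paint : ∀ c e P → f (paint c e P) ≡ c ⊎ f (paint c e P) ≡ e
  f-paint c e P with i , colour≡ ← f-tabulate (λ i → if P i then c else e) =
    by-colour (P i) colour≡
    where
    by-colour : ∀ b → (if b then c else e) ≡ f (paint c e P) →
      f (paint c e P) ≡ c ⊎ f (paint c e P) ≡ e
    by-colour true  c≡ = inj₁ (≡.sym c≡)
    by-colour false e≡ = inj₂ (≡.sym e≡)

  f-paint-≢ʳ : f (paint c e P) ≢ e → f (paint c e P) ≡ c
  f-paint-≢ʳ {c} {e} {P} ≢e = [ id , (λ ≡e → contradiction ≡e ≢e) ]′ (f-paint c e P)

  f-paint-≢ˡ : f (paint c e P) ≢ c → f (paint c e P) ≡ e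
  f-paint-≢ˡ {c} {e} {P} ≢c = [ (λ ≡c → contradiction ≡c ≢c) , id ]′ (f-paint c e P)

  paint-cong : P ≗ Q → paint c e P ≡ paint c e Q
  paint-cong {c = c} {e} P≗Q = tabulate-cong λ i → cong (λ b → if b then c else e) (P≗Q i)

  paint-∁ : ∀ c e P → paint c e P ≡ paint e c (∁ P)
  paint-∁ c e P = tabulate-cong λ i → swap (P i)
    where
    swap : ∀ b → (if b then c else e) ≡ (if not b then e else c)
    swap true  = refl
    swap false = refl

  paint-apart : c ≢ c' → e ≢ e' → Apart (paint c e P) (paint c' e' P)
  paint-apart {c} {c'} {e} {e'} {P} c≢c' e≢e' i =
    subst₂ _≢_ (≡.sym (lookup∘tabulate _ i)) (≡.sym (lookup∘tabulate _ i)) (apart (P i))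
    where
    apart : ∀ b → (if b then c else e) ≢ (if b then c' else e')
    apart true  = c≢c'
    apart false = e≢e'

  paint-fibre-apart : x ≢ c → Apart (paint x c (fibre a c)) a
  paint-fibre-apart {x} {c} {a} x≢c i =
    subst (_≢ lookup a i) (≡.sym (lookup∘tabulate _ i)) (apart (lookup a i ≟ c))
    where
    apart : ∀ {y} (y≟c : Dec (y ≡ c)) → (if does y≟c then x else c) ≢ y
    apart (yes y≡c) x≡y = x≢c (trans x≡y y≡c)
    apart (no  y≢c) c≡y = y≢c (≡.sym c≡y)

  fibre-tabulate : (g : Fin m → Colour) → ∀ c i → fibre (tabulate g) c i ≡ does (g i ≟ c)
  fibre-tabulate g c i = cong (λ y → does (y ≟ c)) (lookup∘tabulate g i)

  fibre-paint : e ≢ c → fibre (paint c e P) c ≗ P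
  fibre-paint {e} {c} {P} e≢c i = trans (fibre-tabulate _ c i) (by-colour (P i))
    where
    by-colour : ∀ b → does ((if b then c else e) ≟ c) ≡ b
    by-colour true  = dec-true (c ≟ c) refl
    by-colour false = dec-false (e ≟ c) e≢c

  fibre-paint-∁ : c ≢ e → fibre (paint c e P) e ≗ ∁ P
  fibre-paint-∁ {c} {e} {P} c≢e i = trans (fibre-tabulate _ e i) (by-colour (P i))
    where
    by-colour : ∀ b → does ((if b then c else e) ≟ e) ≡ not b
    by-colour true  = dec-false (c ≟ e) c≢e
    by-colour false = dec-true (e ≟ e) refl

  Wins : Colour → Colour → Coalition → Set
  Wins c e P = f (paint c e P) ≡ c

  wins-cong : P ≗ Q → Wins c e P → Wins c e Q
  wins-cong P≗Q c-wins = trans (cong f (≡.sym (paint-cong P≗Q))) c-wins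

  value⇔wins-fibre : e ≢ c → f a ≡ c ⇔ Wins c e (fibre a c)
  value⇔wins-fibre {e} {c} {a} e≢c = mk⇔ value⇒wins wins⇒value
    where
    c≢e : c ≢ e
    c≢e = e≢c ∘ ≡.sym

    value⇒wins : f a ≡ c → Wins c e (fibre a c)
    value⇒wins fa≡c =
      f-paint-≢ʳ λ ≡e → f-apart (paint-apart c≢e e≢c) (trans ≡e (≡.sym e-wins-swapped))
      where
      e-wins-swapped : Wins e c (fibre a c)
      e-wins-swapped =
        f-paint-≢ʳ λ ≡c → f-apart (paint-fibre-apart {a = a} e≢c) (trans ≡c (≡.sym fa≡c))

    wins⇒value : Wins c e (fibre a c) → f a ≡ c
    wins⇒value c-wins with f a ≟ c
    ... | yes fa≡c = fa≡c
    ... | no  fa≢c = contradiction (trans c-wins (≡.sym c-beats-fa))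
                                   (f-apart (paint-apart (fa≢c ∘ ≡.sym) e≢c))
      where
      c-beats-fa : f (paint (f a) c (fibre a c)) ≡ c
      c-beats-fa = f-paint-≢ˡ λ ≡fa → f-apart (paint-fibre-apart {a = a} fa≢c) ≡fa

  wins-change-loser : e ≢ c → e' ≢ c → Wins c e P → Wins c e' P
  wins-change-loser {e} {c} {e'} {P} e≢c e'≢c c-wins =
    wins-cong (fibre-paint e≢c) (to (value⇔wins-fibre {a = paint c e P} e'≢c) c-wins)

  wins⇒¬wins-∁ : c ≢ e → Wins c e P → ¬ Wins e c (∁ P)
  wins⇒¬wins-∁ {c} {e} {P} c≢e c-wins e-wins =
    c≢e (trans (≡.sym c-wins) (trans (cong f (paint-∁ c e P)) e-wins))

  ¬wins-∁⇒wins : ¬ Wins e c (∁ P) → Wins c e P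
  ¬wins-∁⇒wins {e} {c} {P} ¬e-wins =
    f-paint-≢ʳ λ ≡e → ¬e-wins (trans (cong f (≡.sym (paint-∁ c e P))) ≡e)

  wins-change-winner : c ≢ e → c' ≢ e → Wins c e P → Wins c' e P
  wins-change-winner c≢e c'≢e c-wins =
    ¬wins-∁⇒wins λ e-beats-c' → wins⇒¬wins-∁ c≢e c-wins (wins-change-loser c'≢e c≢e e-beats-c')

  wins-recolour : c ≢ e → c' ≢ e' → Wins c e P → Wins c' e' P
  wins-recolour {c} {e} {c'} {e'} c≢e c'≢e' c-wins with g , g≢c , g≢c' ← third c c' =
    wins-change-loser g≢c' (c'≢e' ∘ ≡.sym)
      (wins-change-winner (g≢c ∘ ≡.sym) (g≢c' ∘ ≡.sym)
        (wins-change-loser (c≢e ∘ ≡.sym) g≢c c-wins))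

  Decisive : Coalition → Set
  Decisive = Wins c₀ c₁

  value⇔decisive-fibre : f a ≡ c ⇔ Decisive (fibre a c)
  value⇔decisive-fibre {a} {c} with e , e≢c , _ ← third c c =
    mk⇔ (wins-recolour (e≢c ∘ ≡.sym) (λ ()) ∘ to (value⇔wins-fibre e≢c))
        (from (value⇔wins-fibre e≢c) ∘ wins-recolour (λ ()) (e≢c ∘ ≡.sym))

  f-constant : ∀ x → f (tabulate (const x)) ≡ x
  f-constant x = begin
    f (tabulate (const x))                ≡⟨ cong f (tabulate-cong λ i → ≡.sym (lookup-replicate i x)) ⟩
    f (tabulate (lookup (replicate m x))) ≡⟨ cong f (tabulate∘lookup (replicate m x)) ⟩
    f (replicate m x)                     ≡⟨ f-idempotent x ⟩
    x                                     ∎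

  decisive-⊤ : Decisive (const true)
  decisive-⊤ = f-constant c₀

  ¬decisive-∅ : ¬ Decisive (const false)
  ¬decisive-∅ c₀-wins = contradiction (trans (≡.sym (f-constant c₁)) c₀-wins) λ ()

  decisive-or-∁ : ∀ P → Decisive P ⊎ Decisive (∁ P)
  decisive-or-∁ P = [ inj₁ , inj₂ ∘ wins-cong (fibre-paint-∁ (λ ())) ∘ to value⇔decisive-fibre ]′
    (f-paint c₀ c₁ P)

  ¬decisive-both : Decisive P → ¬ Decisive (∁ P)
  ¬decisive-both {P} c₀-wins decisive-∁ = contradiction (trans (≡.sym c₀-wins) c₁-wins) λ ()
    where
    c₁-wins : f (paint c₀ c₁ P) ≡ c₁
    c₁-wins = from value⇔decisive-fibre (wins-cong (≡.sym ∘ fibre-paint-∁ (λ ())) decisive-∁)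

  fibre-tricolour₀ : ∀ A B → fibre (tricolour A B) c₀ ≗ A ∩ B
  fibre-tricolour₀ A B i = trans (fibre-tabulate _ c₀ i) (by-colour (A i) (B i))
    where
    by-colour : ∀ a b → does ((if b then (if a then c₀ else c₁) else c₂) ≟ c₀) ≡ a ∧ b
    by-colour true  true  = refl
    by-colour false true  = refl
    by-colour true  false = refl
    by-colour false false = refl

  fibre-tricolour₁ : ∀ A B → fibre (tricolour A B) c₁ ≗ B ∖ A
  fibre-tricolour₁ A B i = trans (fibre-tabulate _ c₁ i) (by-colour (A i) (B i))
    where
    by-colour : ∀ a b → does ((if b then (if a then c₀ else c₁) else c₂) ≟ c₁) ≡ b ∧ not a
    by-colour true  true  = refl
    by-colour false true  = refl
    by-colour _     false = refl

  fibre-tricolour₂ : ∀ A B → fibre (tricolour A B) c₂ ≗ ∁ B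
  fibre-tricolour₂ A B i = trans (fibre-tabulate _ c₂ i) (by-colour (A i) (B i))
    where
    by-colour : ∀ a b → does ((if b then (if a then c₀ else c₁) else c₂) ≟ c₂) ≡ not b
    by-colour true  true  = refl
    by-colour false true  = refl
    by-colour _     false = refl

  f-tricolour : ∀ A B →
    f (tricolour A B) ≡ c₀ ⊎ f (tricolour A B) ≡ c₁ ⊎ f (tricolour A B) ≡ c₂
  f-tricolour A B
    with i , colour≡ ← f-tabulate (λ i → if B i then (if A i then c₀ else c₁) else c₂) =
    by-colour (A i) (B i) colour≡
    where
    by-colour : ∀ p q → (if q then (if p then c₀ else c₁) else c₂) ≡ f (tricolour A B) →
      f (tricolour A B) ≡ c₀ ⊎ f (tricolour A B) ≡ c₁ ⊎ f (tricolour A B) ≡ c₂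
    by-colour true  true  ≡fa = inj₁ (≡.sym ≡fa)
    by-colour false true  ≡fa = inj₂ (inj₁ (≡.sym ≡fa))
    by-colour _     false ≡fa = inj₂ (inj₂ (≡.sym ≡fa))

  ⊆⇒∩≗ : P ⊆ Q → P ∩ Q ≗ P
  ⊆⇒∩≗ {P} {Q} P⊆Q i = absorb (P i) (Q i) (P⊆Q i)
    where
    absorb : ∀ p q → (T p → T q) → p ∧ q ≡ p
    absorb true  true  _   = refl
    absorb true  false p⇒q = contradiction (p⇒q _) id
    absorb false _     _   = refl

  decisive-mono : P ⊆ Q → Decisive P → Decisive Q
  decisive-mono {P} {Q} P⊆Q decisive-P with decisive-or-∁ Q
  ... | inj₁ decisive-Q = decisive-Q
  ... | inj₂ decisive-∁Q = contradiction (trans (≡.sym value-c₀) value-c₂) λ ()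
    where
    value-c₀ : f (tricolour P Q) ≡ c₀
    value-c₀ = from value⇔decisive-fibre
      (wins-cong (λ i → ≡.sym (trans (fibre-tricolour₀ P Q i) (⊆⇒∩≗ P⊆Q i))) decisive-P)
    value-c₂ : f (tricolour P Q) ≡ c₂
    value-c₂ = from value⇔decisive-fibre (wins-cong (≡.sym ∘ fibre-tricolour₂ P Q) decisive-∁Q)

  ∩-⊆ˡ : ∀ P Q → P ∩ Q ⊆ P
  ∩-⊆ˡ P Q i = proj₁ ∘ to (T-∧ {P i} {Q i})

  decisive-split : ∀ t → Decisive Q → Decisive ⁅ t ⁆ ⊎ Decisive (Q ∖ ⁅ t ⁆)
  decisive-split {Q} t decisive-Q with f-tricolour ⁅ t ⁆ Q
  ... | inj₁ value-c₀ =
    inj₁ (decisive-mono (∩-⊆ˡ ⁅ t ⁆ Q)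
      (wins-cong (fibre-tricolour₀ ⁅ t ⁆ Q) (to value⇔decisive-fibre value-c₀)))
  ... | inj₂ (inj₁ value-c₁) =
    inj₂ (wins-cong (fibre-tricolour₁ ⁅ t ⁆ Q) (to value⇔decisive-fibre value-c₁))
  ... | inj₂ (inj₂ value-c₂) =
    contradiction (wins-cong (fibre-tricolour₂ ⁅ t ⁆ Q) (to value⇔decisive-fibre value-c₂))
                  (¬decisive-both decisive-Q)

  open import Data.List.Membership.DecPropositional (_≟_ {m}) using (_∈?_)

  members : List (Fin m) → Coalition
  members L i = does (i ∈? L)

  decisive-singleton : ∀ L → Decisive (members L) → ∃ λ t → Decisive ⁅ t ⁆
  decisive-singleton []      decisive-∅ = contradiction decisive-∅ ¬decisive-∅
  decisive-singleton (t ∷ L) decisive-tL with decisive-split t decisive-tL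
  ... | inj₁ decisive-t    = t , decisive-t
  ... | inj₂ decisive-rest = decisive-singleton L (decisive-mono rest⊆L decisive-rest)
    where
    rest⊆L : members (t ∷ L) ∖ ⁅ t ⁆ ⊆ members L
    rest⊆L i = drop (does (i ≟ t)) (does (i ∈? L))
      where
      drop : ∀ p q → T ((p ∨ q) ∧ not p) → T q
      drop false true  _ = _
      drop false false ()
      drop true  _     ()

  ⊤⊆allFin : const true ⊆ members (allFin m)
  ⊤⊆allFin i _ = from T-≡ (dec-true (i ∈? allFin m) (∈-allFin i))

  singleton⊆fibre : ∀ a t → ⁅ t ⁆ ⊆ fibre a (lookup a t)
  singleton⊆fibre a t i with i ≟ t
  ... | yes refl = λ _ → from T-≡ (dec-true (lookup a i ≟ lookup a i) refl)
  ... | no  _    = λ ()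

  projection : IsProjection f
  projection with t , decisive-t ← decisive-singleton (allFin m) (decisive-mono ⊤⊆allFin decisive-⊤) =
    t , λ a → from value⇔decisive-fibre (decisive-mono (singleton⊆fibre a t) decisive-t)

-- The canonical pp-formula of a power of H

encode : Vec (Fin k) m → Fin (k ℕ.^ m)
encode a = funToFin (lookup a)

decode : Fin (k ℕ.^ m) → Vec (Fin k) m
decode p = tabulate (finToFun p)

decode-encode : (a : Vec (Fin k) m) → decode (encode a) ≡ a
decode-encode a = trans (tabulate-cong (finToFun-funToFin (lookup a))) (tabulate∘lookup a)

module PowerFormula (H : Graph k) (m : ℕ) where

  PowerVertex : Set
  PowerVertex = Fin (k ℕ.^ m)

  tuple : PowerVertex → Vec (Fin k) m
  tuple = decode

  PowerAdjacent : PowerVertex × PowerVertex → Set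
  PowerAdjacent (p , q) = Pointwise (Edge H) (tuple p) (tuple q)

  power-adjacent? : ∀ pq → Dec (PowerAdjacent pq)
  power-adjacent? (p , q) = Pointwise.decidable (λ x y → T? (adj H x y)) (tuple p) (tuple q)

  power-edges : List (PowerVertex × PowerVertex)
  power-edges = filter power-adjacent? (cartesianProduct (allFin _) (allFin _))

  variable-of : PowerVertex → Fin (2 + k ℕ.^ m)
  variable-of p = suc (suc p)

  power-formula : Vec (Fin k) m → Vec (Fin k) m → PPFormula 2 2
  power-formula u v = record
    { n'       = k ℕ.^ m
    ; R-atoms  = map (λ (p , q) → variable-of p ∷ variable-of q ∷ []) power-edges
    ; EQ-atoms = (zero ∷ variable-of (encode u) ∷ [])
               ∷ (suc zero ∷ variable-of (encode v) ∷ [])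
               ∷ []
    }

  PolymorphicImage : Vec (Fin k) m → Vec (Fin k) m → Fin k → Fin k → Set
  PolymorphicImage u v x y = ∃ λ g → IsPolymorphism H g × g u ≡ x × g v ≡ y

  power-formula⇔polymorphic-image : ∀ u v {x y} →
    ⟦ power-formula u v ⟧ (EdgeRel H) (x ∷ y ∷ []) ⇔ PolymorphicImage u v x y
  power-formula⇔polymorphic-image u v {x} {y} = mk⇔ solution⇒image image⇒solution
    where
    solution⇒image : ⟦ power-formula u v ⟧ (EdgeRel H) (x ∷ y ∷ []) → PolymorphicImage u v x y
    solution⇒image (ys , edges-hold , x≡gu ∷ y≡gv ∷ []) = g , g-poly , ≡.sym x≡gu , ≡.sym y≡gv
      where
      g : Op k m
      g a = lookup ys (encode a)
      g-poly : IsPolymorphism H g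
      g-poly as bs as~bs = All.lookup edges-hold (∈-map⁺ _ (∈-filter⁺ power-adjacent?
        (∈-cartesianProduct⁺ (∈-allFin _) (∈-allFin _))
        (subst₂ (Pointwise (Edge H)) (≡.sym (decode-encode as)) (≡.sym (decode-encode bs)) as~bs)))

    image⇒solution : PolymorphicImage u v x y → ⟦ power-formula u v ⟧ (EdgeRel H) (x ∷ y ∷ [])
    image⇒solution (g , g-poly , gu≡x , gv≡y) =
      ys , All.tabulate edge-holds , equal u gu≡x ∷ equal v gv≡y ∷ []
      where
      ys = tabulate (g ∘ tuple)
      lookup-ys : ∀ p → lookup ys p ≡ g (tuple p)
      lookup-ys = lookup∘tabulate (g ∘ tuple)
      equal : ∀ w {z} → g w ≡ z → z ≡ lookup ys (encode w)
      equal w gw≡z = ≡.sym (trans (lookup-ys (encode w)) (trans (cong g (decode-encode w)) gw≡z))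
      edge-holds : ∀ {atom} → atom ∈ R-atoms (power-formula u v) →
        EdgeRel H (inst (x ∷ y ∷ ys) atom)
      edge-holds atom∈ with (p , q) , pq∈ , refl ← ∈-map⁻ _ atom∈ =
        subst₂ (Edge H) (≡.sym (lookup-ys p)) (≡.sym (lookup-ys q))
          (g-poly _ _ (proj₂ (∈-filter⁻ power-adjacent?
            {xs = cartesianProduct (allFin _) (allFin _)} pq∈)))

-- Coordinate combine x j of firsts and seconds holds the pair (x , punchIn x j).
module DistinctPairs (k : ℕ) where

  firsts seconds : Vec (Fin (suc k)) (suc k * k)
  firsts  = tabulate λ t → proj₁ (remQuot {suc k} k t)
  seconds = tabulate λ t → punchIn (proj₁ (remQuot {suc k} k t)) (proj₂ (remQuot {suc k} k t))

  firsts-seconds-apart : Apart firsts seconds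
  firsts-seconds-apart t first≡second =
    punchInᵢ≢i _ _ (≡.sym (subst₂ _≡_ (lookup∘tabulate _ t) (lookup∘tabulate _ t) first≡second))

  every-pair-occurs : ∀ {x y} → x ≢ y → ∃ λ t → lookup firsts t ≡ x × lookup seconds t ≡ y
  every-pair-occurs {x} {y} x≢y = t , first≡x , second≡y
    where
    j = punchOut x≢y
    t = combine x j
    first≡x : lookup firsts t ≡ x
    first≡x = trans (lookup∘tabulate _ t) (cong proj₁ (remQuot-combine x j))
    second≡y : lookup seconds t ≡ y
    second≡y = begin
      lookup seconds t                                    ≡⟨ lookup∘tabulate _ t ⟩
      punchIn (proj₁ (remQuot k t)) (proj₂ (remQuot k t)) ≡⟨ cong (λ (i , j) → punchIn i j)
                                                                  (remQuot-combine x j) ⟩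
      punchIn x j                                         ≡⟨ punchIn-punchOut x≢y ⟩
      y                                                   ∎

pointwise-replicate : {A B : Set} {R : A → B → Set} {x : A} {y : B} →
  R x y → Pointwise R (replicate m x) (replicate m y)
pointwise-replicate {m = zero}  xy = []
pointwise-replicate {m = suc m} xy = xy ∷ pointwise-replicate xy

projection-isPolymorphism : (H : Graph k) (t : Fin m) → IsPolymorphism H (λ a → lookup a t)
projection-isPolymorphism H t _ _ as~bs = Pointwise.lookup as~bs t

core⇒idempotent-polymorphism : {H : Graph k} → IsCore H → {g : Op k m} → IsPolymorphism H g →
  ∃ λ β → IsPolymorphism H (β ∘ g) × IsIdempotent (β ∘ g)
core⇒idempotent-polymorphism {H = H} core {g} g-poly =
  let β , β-hom , β-inverse = injective-hom⇒inverse-hom H α-hom (proj₁ (core α α-hom))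
  in  β , (λ as bs as~bs → β-hom _ _ (g-poly as bs as~bs)) , β-inverse
  where
  α : Fin _ → Fin _
  α x = g (replicate _ x)
  α-hom : IsHom H α
  α-hom x y xy = g-poly _ _ (pointwise-replicate xy)

NEQ-definable⇒core : {H : Graph k} → PPDefines (EdgeRel H) (NEQ k) → IsCore H
NEQ-definable⇒core {H = H} NEQ-def h h-hom = injective⇒bijective h-injective
  where
  h-apart : ∀ {as bs : Vec _ 1} → Apart as bs → h (lookup as zero) ≢ h (lookup bs zero)
  h-apart {as} {bs} = NEQ-definable⇒polymorphism-apart NEQ-def {f = λ v → h (lookup v zero)}
    (λ _ _ as~bs → h-hom _ _ (Pointwise.lookup as~bs zero)) {as} {bs}
  h-injective : Injective _≡_ _≡_ h
  h-injective {x} {y} hx≡hy with x ≟ y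
  ... | yes x≡y = x≡y
  ... | no  x≢y = contradiction hx≡hy (h-apart {x ∷ []} {y ∷ []} λ { zero → x≢y })

NEQ-definable⇒projective : {H : Graph (3 + n)} → PPDefines (EdgeRel H) (NEQ (3 + n)) → IsProjective H
NEQ-definable⇒projective NEQ-def m f f-poly f-idempotent =
  IdempotentApartnessPreserving.projection f f-idempotent
    (NEQ-definable⇒polymorphism-apart NEQ-def f-poly)

core×projective⇒NEQ-definable : {H : Graph (suc k)} → IsCore H → IsProjective H →
  PPDefines (EdgeRel H) (NEQ (suc k))
core×projective⇒NEQ-definable {k} {H} core projective =
  power-formula firsts seconds , λ { (x ∷ y ∷ []) → mk⇔ neq⇒solution solution⇒neq }
  where
  open DistinctPairs k
  open PowerFormula H (suc k * k)

  neq⇒solution : ∀ {x y} → x ≢ y → ⟦ power-formula firsts seconds ⟧ (EdgeRel H) (x ∷ y ∷ [])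
  neq⇒solution x≢y with t , firstₜ≡x , secondₜ≡y ← every-pair-occurs x≢y =
    from (power-formula⇔polymorphic-image firsts seconds)
      ((λ a → lookup a t) , projection-isPolymorphism H t , firstₜ≡x , secondₜ≡y)

  solution⇒neq : ∀ {x y} → ⟦ power-formula firsts seconds ⟧ (EdgeRel H) (x ∷ y ∷ []) → x ≢ y
  solution⇒neq solution x≡y
    with g , g-poly , g-firsts≡x , g-seconds≡y
           ← to (power-formula⇔polymorphic-image firsts seconds) solution
    with β , βg-poly , βg-idempotent ← core⇒idempotent-polymorphism {H = H} core g-poly
    with t , βg≡projₜ ← projective _ (β ∘ g) βg-poly βg-idempotent
    = firsts-seconds-apart t (begin
      lookup firsts t  ≡⟨ βg≡projₜ firsts ⟨
      β (g firsts)     ≡⟨ cong β (trans g-firsts≡x (trans x≡y (≡.sym g-seconds≡y))) ⟩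
      β (g seconds)    ≡⟨ βg≡projₜ seconds ⟩
      lookup seconds t ∎)

corollary4p2 : (k : ℕ) → 3 ≤ k → (H : Graph k) →
    (PPDefines (EdgeRel H) (NEQ k) ⇔ (IsCore H × IsProjective H))
corollary4p2 _ (s≤s (s≤s (s≤s _))) H = mk⇔
  (λ NEQ-def → NEQ-definable⇒core NEQ-def , NEQ-definable⇒projective NEQ-def)
  (λ (core , projective) → core×projective⇒NEQ-definable core projective)
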